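{- Let $k$ be a positive integer and let $G_k$ be a graph that has no packing $(1^2,2^k)$-coloring but every proper subgraph of which has a packing $(1^2,2^k)$-coloring. Then $G_k$ contains no $3$-thread, i.e., no path on three vertices each of which has degree $2$ in $G_k$.
   Context: All graphs are finite and simple. A set of vertices is $i$-independent if any two distinct vertices in it are at distance at least $i+1$. A packing $(1^{\ell},2^{k})$-coloring of $G$ is a partition of $V(G)$ into $\ell$ independent sets and $k$ $2$-independent sets (some parts may be empty). A $t$-thread is a path on $t$ vertices all of degree $2$ in the graph. -}

module Defs where

open import Data.Nat using (ℕ; suc)
open import Data.Fin using (Fin)
open import Data.Bool using (Bool; true; false; if_then_else_)
open import Data.List using (List; map; allFin)
open import Data.Nat.ListAction using (sum)
open import Data.Product using (Σ; ∃; _×_; _,_; proj₁)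
open import Data.Sum using (_⊎_; inj₁; inj₂)
open import Relation.Binary.PropositionalEquality using (_≡_)
open import Relation.Nullary using (¬_)

record Graph : Set where
  field
    n     : ℕ
    adj   : Fin n → Fin n → Bool
    sym   : ∀ u v → adj u v ≡ adj v u
    irrefl : ∀ v → adj v v ≡ false

module _ (G : Graph) where
  open Graph G

  Edge : Fin n → Fin n → Set
  Edge u v = adj u v ≡ true

  degree : Fin n → ℕ
  degree v = sum (map (λ u → if adj v u then 1 else 0) (allFin n))

  Has3Thread : Set
  Has3Thread = Σ (Fin n) λ a → Σ (Fin n) λ b → Σ (Fin n) λ c →
    Edge a b × Edge b c × ¬ (a ≡ c) ×
    degree a ≡ 2 × degree b ≡ 2 × degree c ≡ 2

-- Packing (1^ℓ, 2^k)-colouring of an arbitrary graph with vertex type V and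
-- (symmetric) edge relation E: each vertex receives a colour in Fin ℓ ⊎ Fin k;
-- colour classes inj₁ i are independent sets, colour classes inj₂ j are
-- 2-independent sets (distinct vertices at distance ≥ 3, i.e. neither
-- adjacent nor sharing a common neighbour).  Empty classes are allowed.
PackingColoring : (V : Set) → (V → V → Set) → ℕ → ℕ → Set
PackingColoring V E ℓ k =
  Σ (V → Fin ℓ ⊎ Fin k) λ c →
    (∀ u v i → c u ≡ inj₁ i → c v ≡ inj₁ i → ¬ (u ≡ v) → ¬ E u v) ×
    (∀ u v j → c u ≡ inj₂ j → c v ≡ inj₂ j → ¬ (u ≡ v) →
        ¬ E u v × ¬ (Σ V λ w → E u w × E w v))

GraphPackingColorable : Graph → ℕ → ℕ → Set
GraphPackingColorable G ℓ k = PackingColoring (Fin (Graph.n G)) (Edge G) ℓ k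

record Subgraph (G : Graph) : Set where
  open Graph G
  field
    vmask  : Fin n → Bool
    emask  : Fin n → Fin n → Bool
    esym   : ∀ u v → emask u v ≡ emask v u
    ⊆adj   : ∀ u v → emask u v ≡ true → adj u v ≡ true
    ⊆vtx   : ∀ u v → emask u v ≡ true → vmask u ≡ true

module _ {G : Graph} (H : Subgraph G) where
  open Graph G
  open Subgraph H

  SubVertex : Set
  SubVertex = Σ (Fin n) λ v → vmask v ≡ true

  SubEdge : SubVertex → SubVertex → Set
  SubEdge u v = emask (proj₁ u) (proj₁ v) ≡ true

  IsProper : Set
  IsProper = (Σ (Fin n) λ v → vmask v ≡ false)
           ⊎ (Σ (Fin n) λ u → Σ (Fin n) λ v → adj u v ≡ true × emask u v ≡ false)

  SubPackingColorable : ℕ → ℕ → Set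
  SubPackingColorable ℓ k = PackingColoring SubVertex SubEdge ℓ k

-- Delete the thread a–b–c and colour the rest by minimality; we extend this
-- colouring to G.  Besides b, the vertex a has one neighbour x and c one
-- neighbour y, while b has none outside the thread, so no two kept vertices are
-- at distance two through a deleted one and only the colours of x and y
-- constrain the thread.  If x = c the thread is a triangle component: give a and
-- b the two independent colours and c a 2-independent one.  Otherwise, if some
-- independent colour i is used by neither x nor y, colour a and c with i and b
-- with the other independent colour; if not, x and y carry the two independent
-- colours, a and c take the opposite ones, and b takes a 2-independent colour,
-- since everything within distance two of b is a, c, x or y.

module Submission where

open import Defs
open import Axiom.UniquenessOfIdentityProofs using (module Decidable⇒UIP)
open import Data.Bool using (Bool; true; false; _∧_; if_then_else_) renaming (_≟_ to _≟ᵇ_)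
open import Data.Bool.Properties using (∧-comm; ∧-conicalˡ; ∧-conicalʳ)
open import Data.Empty using (⊥)
open import Data.Fin using (Fin; zero; suc; punchIn; punchOut; _≟_)
open import Data.Fin.Properties using (any?; punchIn-punchOut; punchInᵢ≢i; punchOut-injective)
open import Data.List using (List; []; _∷_; tabulate)
open import Data.List.Membership.Propositional using (_∈_; _∉_)
open import Data.List.Properties using (map-tabulate)
open import Data.List.Relation.Unary.Any using (here; there)
open import Data.Nat using (ℕ; zero; suc; _+_; _≤_; s≤s)
open import Data.Nat.ListAction using (sum)
open import Data.Nat.Properties using (+-0-commutativeMonoid; m≤m+n; +-monoʳ-≤; +-identityʳ; +-assoc; module ≤-Reasoning)
open import Data.Product using (Σ; ∃-syntax; _×_; _,_; proj₁; proj₂)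
open import Data.Sum using (_⊎_; inj₁; inj₂; [_,_]′; map₂; swap)
open import Data.Vec.Functional using (removeAt)
open import Function using (_∘_; _∋_; id; case_of_)
open import Relation.Binary.PropositionalEquality using (_≡_; _≢_; refl; sym; trans; cong; cong₂; subst; ≢-sym; module ≡-Reasoning)
open import Relation.Nullary using (¬_; Dec; yes; no; ¬?; contradiction)
open import Relation.Nullary.Decidable using (_×-dec_; dec-true; dec-false; does)

open import Algebra.Properties.CommutativeMonoid.Sum +-0-commutativeMonoid
  using (sum-remove; sum-cong-≗; sum-replicate-zero) renaming (sum to ∑)

sum-tabulate : ∀ {n} (t : Fin n → ℕ) → sum (tabulate t) ≡ ∑ t
sum-tabulate {zero}  t = refl
sum-tabulate {suc n} t = cong (t zero +_) (sum-tabulate (t ∘ suc))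

point≤∑ : ∀ {n} (t : Fin n → ℕ) i → t i ≤ ∑ t
point≤∑ {suc n} t i = subst (t i ≤_) (sym (sum-remove {i = i} t)) (m≤m+n (t i) _)

pair≤∑ : ∀ {n} (t : Fin n → ℕ) {i j} → i ≢ j → t i + t j ≤ ∑ t
pair≤∑ {suc n} t {i} {j} i≢j = begin
  t i + t j                         ≡⟨ cong (λ v → t i + t v) (punchIn-punchOut i≢j) ⟨
  t i + removeAt t i (punchOut i≢j) ≤⟨ +-monoʳ-≤ (t i) (point≤∑ (removeAt t i) _) ⟩
  t i + ∑ (removeAt t i)            ≡⟨ sum-remove t ⟨
  ∑ t                               ∎
  where open ≤-Reasoning

triple≤∑ : ∀ {n} (t : Fin n → ℕ) {i j k} → i ≢ j → i ≢ k → j ≢ k → t i + t j + t k ≤ ∑ t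
triple≤∑ {suc n} t {i} {j} {k} i≢j i≢k j≢k = begin
  t i + t j + t k     ≡⟨ +-assoc (t i) (t j) (t k) ⟩
  t i + (t j + t k)   ≡⟨ cong₂ (λ u v → t i + (t u + t v)) (punchIn-punchOut i≢j) (punchIn-punchOut i≢k) ⟨
  t i + (removeAt t i (punchOut i≢j) + removeAt t i (punchOut i≢k))
                      ≤⟨ +-monoʳ-≤ (t i) (pair≤∑ (removeAt t i) (j≢k ∘ punchOut-injective i≢j i≢k)) ⟩
  t i + ∑ (removeAt t i) ≡⟨ sum-remove t ⟨
  ∑ t                 ∎
  where open ≤-Reasoning

∑-single-support : ∀ {n} (t : Fin n → ℕ) {i} → (∀ j → j ≢ i → t j ≡ 0) → ∑ t ≡ t i
∑-single-support {suc n} t {i} vanish = begin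
  ∑ t                    ≡⟨ sum-remove t ⟩
  t i + ∑ (removeAt t i) ≡⟨ cong (t i +_) (sum-cong-≗ (λ j → vanish (punchIn i j) (punchInᵢ≢i i j))) ⟩
  t i + ∑ {n} (λ _ → 0)  ≡⟨ cong (t i +_) (sum-replicate-zero n) ⟩
  t i + 0                ≡⟨ +-identityʳ (t i) ⟩
  t i                    ∎
  where open ≡-Reasoning

module _ {V : Set} (E : V → V → Set) where

  Within2 : V → V → Set
  Within2 u v = E u v ⊎ Σ V λ w → E u w × E w v

module _ {V : Set} (E : V → V → Set) {ℓ k : ℕ} where

  -- Two distinct vertices coloured γ must not be Near γ.
  Near : Fin ℓ ⊎ Fin k → V → V → Set
  Near (inj₁ _) = E
  Near (inj₂ _) = Within2 E

  ProperAt : (V → Fin ℓ ⊎ Fin k) → V → Set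
  ProperAt c u = ∀ v → u ≢ v → c u ≡ c v → ¬ Near (c u) u v

  Near-sym : (∀ {u v} → E u v → E v u) → ∀ γ {u v} → Near γ u v → Near γ v u
  Near-sym E-sym (inj₁ _) e                     = E-sym e
  Near-sym E-sym (inj₂ _) (inj₁ e)              = inj₁ (E-sym e)
  Near-sym E-sym (inj₂ _) (inj₂ (w , e₁ , e₂)) = inj₂ (w , E-sym e₂ , E-sym e₁)

  packing⇒properAt : (P : PackingColoring V E ℓ k) → ∀ u → ProperAt (proj₁ P) u
  packing⇒properAt (c , first , second) u v u≢v same = clash (c u) refl
    where
    clash : ∀ γ → c u ≡ γ → ¬ Near γ u v
    clash (inj₁ i) cu = first u v i cu (trans (sym same) cu) u≢v
    clash (inj₂ j) cu (inj₁ e) = proj₁ (second u v j cu (trans (sym same) cu) u≢v) e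
    clash (inj₂ j) cu (inj₂ p) = proj₂ (second u v j cu (trans (sym same) cu) u≢v) p

  properAt⇒packing : (c : V → Fin ℓ ⊎ Fin k) → (∀ u → ProperAt c u) → PackingColoring V E ℓ k
  properAt⇒packing c proper = c , first , second
    where
    first : ∀ u v i → c u ≡ inj₁ i → c v ≡ inj₁ i → u ≢ v → ¬ E u v
    first u v i cu cv u≢v e = proper u v u≢v (trans cu (sym cv)) (subst (λ γ → Near γ u v) (sym cu) e)
    second : ∀ u v j → c u ≡ inj₂ j → c v ≡ inj₂ j → u ≢ v → ¬ E u v × ¬ (Σ V λ w → E u w × E w v)
    second u v j cu cv u≢v = (λ e → clash (inj₁ e)) , (λ p → clash (inj₂ p))
      where
      clash : ¬ Within2 E u v
      clash w2 = proper u v u≢v (trans cu (sym cv)) (subst (λ γ → Near γ u v) (sym cu) w2)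

  properAt-first-kind : ∀ {c u i} → c u ≡ inj₁ i → (∀ v → E u v → c v ≢ inj₁ i) → ProperAt c u
  properAt-first-kind {c} {u} cu differ v _ same e = differ v (subst (λ γ → Near γ u v) cu e) (trans (sym same) cu)

  neighbours-avoid : ∀ {c : V → Fin ℓ ⊎ Fin k} {u p q γ} → (∀ v → E u v → v ≡ p ⊎ v ≡ q) →
                     c p ≢ γ → c q ≢ γ → ∀ v → E u v → c v ≢ γ
  neighbours-avoid cover cp cq v e with cover v e
  ... | inj₁ refl = cp
  ... | inj₂ refl = cq

  properAt-second-kind : ∀ {c u j} → c u ≡ inj₂ j → (∀ v → u ≢ v → Within2 E u v → ∃[ i ] c v ≡ inj₁ i) → ProperAt c u
  properAt-second-kind {c} {u} cu first-kind v u≢v same w2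
    with first-kind v u≢v (subst (λ γ → Near γ u v) cu w2)
  ... | i , cv = case trans (sym cu) (trans same cv) of λ ()

module _ (G : Graph) where
  open Graph G renaming (sym to adj-sym)
  open import Data.List.Membership.DecPropositional (_≟_ {n}) using (_∈?_)

  Edge-sym : ∀ {u v} → Edge G u v → Edge G v u
  Edge-sym {u} {v} e = trans (adj-sym v u) e

  Edge⇒≢ : ∀ {u v} → Edge G u v → u ≢ v
  Edge⇒≢ {u} e refl = case trans (sym (irrefl u)) e of λ ()

  indicator : Fin n → Fin n → ℕ
  indicator s v = if adj s v then 1 else 0

  degree≡∑ : ∀ s → degree G s ≡ ∑ (indicator s)
  degree≡∑ s = trans (cong sum (map-tabulate id (indicator s))) (sum-tabulate (indicator s))

  indicator-Edge : ∀ {s v} → Edge G s v → indicator s v ≡ 1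
  indicator-Edge e rewrite e = refl

  degree-2-neighbours : ∀ {s p q} → degree G s ≡ 2 → Edge G s p → Edge G s q → p ≢ q →
                        ∀ v → Edge G s v → v ≡ p ⊎ v ≡ q
  degree-2-neighbours {s} {p} {q} deg sp sq p≢q v sv with v ≟ p | v ≟ q
  ... | yes v≡p | _       = inj₁ v≡p
  ... | no _    | yes v≡q = inj₂ v≡q
  ... | no v≢p  | no v≢q  = case subst (3 ≤_) deg three≤degree of λ { (s≤s (s≤s ())) }
    where
    three≤degree : 3 ≤ degree G s
    three≤degree = begin
      3                                             ≡⟨ cong₂ _+_ (cong₂ _+_ (indicator-Edge sp) (indicator-Edge sq)) (indicator-Edge sv) ⟨
      indicator s p + indicator s q + indicator s v ≤⟨ triple≤∑ (indicator s) p≢q (≢-sym v≢p) (≢-sym v≢q) ⟩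
      ∑ (indicator s)                               ≡⟨ degree≡∑ s ⟨
      degree G s                                    ∎
      where open ≤-Reasoning

  degree-2-second-neighbour : ∀ {s p} → degree G s ≡ 2 → Edge G s p → Σ (Fin n) λ q → Edge G s q × p ≢ q
  degree-2-second-neighbour {s} {p} deg sp
    with any? (λ q → (adj s q ≟ᵇ true) ×-dec ¬? (p ≟ q))
  ... | yes found = found
  ... | no none = case trans (sym deg) degree≡1 of λ ()
    where
    indicator-off-p : ∀ v → v ≢ p → indicator s v ≡ 0
    indicator-off-p v v≢p with adj s v in sv
    ... | true  = contradiction (v , sv , ≢-sym v≢p) none
    ... | false = refl

    degree≡1 : degree G s ≡ 1
    degree≡1 = begin
      degree G s      ≡⟨ degree≡∑ s ⟩
      ∑ (indicator s) ≡⟨ ∑-single-support (indicator s) indicator-off-p ⟩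
      indicator s p   ≡⟨ indicator-Edge sp ⟩
      1               ∎
      where open ≡-Reasoning

  module _ (R : List (Fin n)) where

    keep : Fin n → Bool
    keep v = does (¬? (v ∈? R))

    keep-∉ : ∀ {v} → v ∉ R → keep v ≡ true
    keep-∉ {v} = dec-true (¬? (v ∈? R))

    keep-∈ : ∀ {v} → v ∈ R → keep v ≡ false
    keep-∈ {v} v∈R = dec-false (¬? (v ∈? R)) (λ v∉R → v∉R v∈R)

    kept⇒∉ : ∀ {v} → keep v ≡ true → v ∉ R
    kept⇒∉ kept v∈R = case trans (sym kept) (keep-∈ v∈R) of λ ()

    deleteVertices : Subgraph G
    deleteVertices = record
      { vmask = keep
      ; emask = λ u v → adj u v ∧ (keep u ∧ keep v)
      ; esym  = λ u v → cong₂ _∧_ (adj-sym u v) (∧-comm (keep u) (keep v))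
      ; ⊆adj  = λ u v → ∧-conicalˡ (adj u v) _
      ; ⊆vtx  = λ u v e → ∧-conicalˡ (keep u) (keep v) (∧-conicalʳ (adj u v) _ e)
      }

    deleteVertices-proper : ∀ {v} → v ∈ R → IsProper deleteVertices
    deleteVertices-proper {v} v∈R = inj₁ (v , keep-∈ v∈R)

    Edge⇒SubEdge : ∀ {u v} → Edge G u v → (p : keep u ≡ true) (q : keep v ≡ true) →
                   SubEdge deleteVertices (u , p) (v , q)
    Edge⇒SubEdge e p q rewrite e | p | q = refl

    -- The equation is kept so that the kept branch has the proof that κ needs.
    glueAt : {C : Set} → (Fin n → C) → (SubVertex deleteVertices → C) → ∀ v b → keep v ≡ b → C
    glueAt σ κ v true  kept = κ (v , kept)
    glueAt σ κ v false _    = σ v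

    glue : {C : Set} → (Fin n → C) → (SubVertex deleteVertices → C) → Fin n → C
    glue σ κ v = glueAt σ κ v (keep v) refl

    glue-∈ : ∀ {C} (σ : Fin n → C) κ {v} → v ∈ R → glue σ κ v ≡ σ v
    glue-∈ σ κ {v} v∈R = at (keep v) refl
      where
      at : ∀ b (eq : keep v ≡ b) → glueAt σ κ v b eq ≡ σ v
      at true  kept = contradiction v∈R (kept⇒∉ kept)
      at false _    = refl

    glue-kept : ∀ {C} (σ : Fin n → C) κ {v} (p : keep v ≡ true) → glue σ κ v ≡ κ (v , p)
    glue-kept σ κ {v} p = at (keep v) refl
      where
      at : ∀ b (eq : keep v ≡ b) → glueAt σ κ v b eq ≡ κ (v , p)
      at true  kept    = cong (λ q → κ (v , q)) (Decidable⇒UIP.≡-irrelevant _≟ᵇ_ kept p)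
      at false dropped = case trans (sym p) dropped of λ ()

    AtMostOneNeighbourOutside : Fin n → Set
    AtMostOneNeighbourOutside w = ∀ {u v} → u ∉ R → v ∉ R → Edge G w u → Edge G w v → u ≡ v

    -- A path through a deleted vertex would give it two distinct outside neighbours.
    Near-restrict : (∀ {w} → w ∈ R → AtMostOneNeighbourOutside w) →
      ∀ {ℓ k} (γ : Fin ℓ ⊎ Fin k) {u v} → u ≢ v → (p : keep u ≡ true) (q : keep v ≡ true) →
      Near (Edge G) γ u v → Near (SubEdge deleteVertices) γ (u , p) (v , q)
    Near-restrict _ (inj₁ _) _ p q e = Edge⇒SubEdge e p q
    Near-restrict _ (inj₂ _) _ p q (inj₁ e) = inj₁ (Edge⇒SubEdge e p q)
    Near-restrict one (inj₂ _) u≢v p q (inj₂ (w , e₁ , e₂)) with w ∈? R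
    ... | yes w∈R = contradiction (one w∈R (kept⇒∉ p) (kept⇒∉ q) (Edge-sym e₁) e₂) u≢v
    ... | no w∉R  = inj₂ ((w , keep-∉ w∉R) , Edge⇒SubEdge e₁ p (keep-∉ w∉R) , Edge⇒SubEdge e₂ (keep-∉ w∉R) q)

    glue-properAt : ∀ {ℓ k} (σ : Fin n → Fin ℓ ⊎ Fin k) (κ : SubVertex deleteVertices → Fin ℓ ⊎ Fin k) →
      (∀ x → ProperAt (SubEdge deleteVertices) κ x) →
      (∀ {w} → w ∈ R → AtMostOneNeighbourOutside w) →
      (∀ {s} → s ∈ R → ProperAt (Edge G) (glue σ κ) s) →
      ∀ u → ProperAt (Edge G) (glue σ κ) u
    glue-properAt σ κ κ-proper one R-proper u v u≢v same near = by-cases (u ∈? R) (v ∈? R)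
      where
      by-cases : Dec (u ∈ R) → Dec (v ∈ R) → ⊥
      by-cases (yes u∈R) _         = R-proper u∈R v u≢v same near
      by-cases (no _)    (yes v∈R) = R-proper v∈R u (≢-sym u≢v) (sym same)
        (Near-sym (Edge G) Edge-sym (glue σ κ v) (subst (λ γ → Near (Edge G) γ u v) same near))
      by-cases (no u∉R)  (no v∉R)  = κ-proper (u , p) (v , q) (u≢v ∘ cong proj₁) κ-same
        (Near-restrict one (κ (u , p)) u≢v p q (subst (λ γ → Near (Edge G) γ u v) (glue-kept σ κ p) near))
        where
        p = keep-∉ u∉R
        q = keep-∉ v∉R
        κ-same = trans (sym (glue-kept σ κ p)) (trans same (glue-kept σ κ q))

≡-≢-trans : ∀ {A : Set} {x y z : A} → x ≡ y → y ≢ z → x ≢ z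
≡-≢-trans x≡y y≢z = y≢z ∘ trans (sym x≡y)

first-kind-via : ∀ {A : Set} {ℓ k} (f : A → Fin ℓ ⊎ Fin k) {u v i} → f u ≡ inj₁ i → v ≡ u → ∃[ i ] f v ≡ inj₁ i
first-kind-via f fu v≡u = _ , trans (cong f v≡u) fu

other : Fin 2 → Fin 2
other zero       = suc zero
other (suc zero) = zero

inj₁≢inj₁-other : ∀ {m} (i : Fin 2) → (Fin 2 ⊎ Fin m ∋ inj₁ i) ≢ inj₁ (other i)
inj₁≢inj₁-other zero       ()
inj₁≢inj₁-other (suc zero) ()

missing-first-colour-or-both : ∀ {m} (γ δ : Fin 2 ⊎ Fin m) →
  (Σ (Fin 2) λ i → γ ≢ inj₁ i × δ ≢ inj₁ i) ⊎ (Σ (Fin 2) λ j → γ ≡ inj₁ j × δ ≡ inj₁ (other j))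
missing-first-colour-or-both (inj₁ zero)       (inj₁ zero)       = inj₁ (suc zero , (λ ()) , (λ ()))
missing-first-colour-or-both (inj₁ zero)       (inj₁ (suc zero)) = inj₂ (zero , refl , refl)
missing-first-colour-or-both (inj₁ (suc zero)) (inj₁ zero)       = inj₂ (suc zero , refl , refl)
missing-first-colour-or-both (inj₁ (suc zero)) (inj₁ (suc zero)) = inj₁ (zero , (λ ()) , (λ ()))
missing-first-colour-or-both (inj₁ i)          (inj₂ _)          = inj₁ (other i , inj₁≢inj₁-other i , (λ ()))
missing-first-colour-or-both (inj₂ _)          (inj₁ i)          = inj₁ (other i , (λ ()) , inj₁≢inj₁-other i)
missing-first-colour-or-both (inj₂ _)          (inj₂ _)          = inj₁ (zero , (λ ()) , (λ ()))

module ThreadColouring {k : ℕ} (G : Graph) {a b c x y : Fin (Graph.n G)}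
  (ab : Edge G a b) (bc : Edge G b c) (ax : Edge G a x) (cy : Edge G c y)
  (a≢c : a ≢ c) (b≢x : b ≢ x) (b≢y : b ≢ y)
  (a-nbrs : ∀ v → Edge G a v → v ≡ b ⊎ v ≡ x)
  (b-nbrs : ∀ v → Edge G b v → v ≡ a ⊎ v ≡ c)
  (c-nbrs : ∀ v → Edge G c v → v ≡ b ⊎ v ≡ y)
  (κ : SubVertex (deleteVertices G (a ∷ b ∷ c ∷ [])) → Fin 2 ⊎ Fin (suc k))
  (κ-proper : ∀ z → ProperAt (SubEdge (deleteVertices G (a ∷ b ∷ c ∷ []))) κ z)
  where

  open Graph G using (n)

  Colour : Set
  Colour = Fin 2 ⊎ Fin (suc k)

  R : List (Fin n)
  R = a ∷ b ∷ c ∷ []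

  a≢b : a ≢ b
  a≢b = Edge⇒≢ G ab

  b≢c : b ≢ c
  b≢c = Edge⇒≢ G bc

  ∉R : ∀ {v} → v ≢ a → v ≢ b → v ≢ c → v ∉ R
  ∉R v≢a _   _   (here v≡a)                 = v≢a v≡a
  ∉R _   v≢b _   (there (here v≡b))         = v≢b v≡b
  ∉R _   _   v≢c (there (there (here v≡c))) = v≢c v≡c

  outside-neighbour : ∀ {s z} → (∀ v → Edge G s v → v ≡ b ⊎ v ≡ z) → ∀ {u} → u ∉ R → Edge G s u → u ≡ z
  outside-neighbour cover {u} u∉R e with cover u e
  ... | inj₁ u≡b = contradiction (there (here u≡b)) u∉R
  ... | inj₂ u≡z = u≡z

  at-most-one-outside : ∀ {w} → w ∈ R → AtMostOneNeighbourOutside G R w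
  at-most-one-outside (here refl) u∉R v∉R e₁ e₂ =
    trans (outside-neighbour a-nbrs u∉R e₁) (sym (outside-neighbour a-nbrs v∉R e₂))
  at-most-one-outside (there (here refl)) {u} u∉R _ e₁ _ with b-nbrs u e₁
  ... | inj₁ u≡a = contradiction (here u≡a) u∉R
  ... | inj₂ u≡c = contradiction (there (there (here u≡c))) u∉R
  at-most-one-outside (there (there (here refl))) u∉R v∉R e₁ e₂ =
    trans (outside-neighbour c-nbrs u∉R e₁) (sym (outside-neighbour c-nbrs v∉R e₂))

  paint : Colour → Colour → Colour → Fin n → Colour
  paint ca cb cc v with v ≟ a | v ≟ b
  ... | yes _ | _     = ca
  ... | no _  | yes _ = cb
  ... | no _  | no _  = cc

  colouring : Colour → Colour → Colour → Fin n → Colour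
  colouring ca cb cc = glue G R (paint ca cb cc) κ

  module _ {ca cb cc : Colour} where

    colour-a : colouring ca cb cc a ≡ ca
    colour-a = trans (glue-∈ G R _ κ (here refl)) paint-a
      where
      paint-a : paint ca cb cc a ≡ ca
      paint-a with a ≟ a
      ... | yes _   = refl
      ... | no a≢a = contradiction refl a≢a

    colour-b : colouring ca cb cc b ≡ cb
    colour-b = trans (glue-∈ G R _ κ (there (here refl))) paint-b
      where
      paint-b : paint ca cb cc b ≡ cb
      paint-b with b ≟ a | b ≟ b
      ... | yes b≡a | _       = contradiction (sym b≡a) a≢b
      ... | no _    | yes _   = refl
      ... | no _    | no b≢b = contradiction refl b≢b

    colour-c : colouring ca cb cc c ≡ cc
    colour-c = trans (glue-∈ G R _ κ (there (there (here refl)))) paint-c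
      where
      paint-c : paint ca cb cc c ≡ cc
      paint-c with c ≟ a | c ≟ b
      ... | yes c≡a | _       = contradiction (sym c≡a) a≢c
      ... | no _    | yes c≡b = contradiction (sym c≡b) b≢c
      ... | no _    | no _    = refl

    colour-outside : ∀ {v} (v∉R : v ∉ R) → colouring ca cb cc v ≡ κ (v , keep-∉ G R v∉R)
    colour-outside v∉R = glue-kept G R _ κ (keep-∉ G R v∉R)

  extend : ∀ ca cb cc →
    ProperAt (Edge G) (colouring ca cb cc) a →
    ProperAt (Edge G) (colouring ca cb cc) b →
    ProperAt (Edge G) (colouring ca cb cc) c →
    GraphPackingColorable G 2 (suc k)
  extend ca cb cc proper-a proper-b proper-c =
    properAt⇒packing (Edge G) (colouring ca cb cc)
      (glue-properAt G R (paint ca cb cc) κ κ-proper at-most-one-outside proper-on-R)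
    where
    proper-on-R : ∀ {s} → s ∈ R → ProperAt (Edge G) (colouring ca cb cc) s
    proper-on-R (here refl)                 = proper-a
    proper-on-R (there (here refl))         = proper-b
    proper-on-R (there (there (here refl))) = proper-c

  triangle : x ≡ c → GraphPackingColorable G 2 (suc k)
  triangle x≡c = extend (inj₁ zero) (inj₁ (suc zero)) (inj₂ zero)
    (properAt-first-kind (Edge G) colour-a
      (neighbours-avoid (Edge G) a-nbrs′ (≡-≢-trans colour-b (λ ())) (≡-≢-trans colour-c (λ ()))))
    (properAt-first-kind (Edge G) colour-b
      (neighbours-avoid (Edge G) b-nbrs (≡-≢-trans colour-a (λ ())) (≡-≢-trans colour-c (λ ()))))
    (properAt-second-kind (Edge G) colour-c first-kind-near-c)
    where
    a-nbrs′ : ∀ v → Edge G a v → v ≡ b ⊎ v ≡ c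
    a-nbrs′ v e = map₂ (λ v≡x → trans v≡x x≡c) (a-nbrs v e)

    y≡a : y ≡ a
    y≡a with c-nbrs a (Edge-sym G (subst (Edge G a) x≡c ax))
    ... | inj₁ a≡b = contradiction a≡b a≢b
    ... | inj₂ a≡y = sym a≡y

    near-c : ∀ v → c ≢ v → Within2 (Edge G) c v → v ≡ a ⊎ v ≡ b
    near-c v _ (inj₁ e) = swap (map₂ (λ v≡y → trans v≡y y≡a) (c-nbrs v e))
    near-c v c≢v (inj₂ (w , e₁ , e₂)) with c-nbrs w e₁
    ... | inj₁ refl = map₂ (λ v≡c → contradiction (sym v≡c) c≢v) (b-nbrs v e₂)
    ... | inj₂ refl = swap (map₂ (λ v≡c → contradiction (sym v≡c) c≢v) (a-nbrs′ v (subst (λ u → Edge G u v) y≡a e₂)))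

    first-kind-near-c : ∀ v → c ≢ v → Within2 (Edge G) c v →
                        ∃[ i ] colouring (inj₁ zero) (inj₁ (suc zero)) (inj₂ zero) v ≡ inj₁ i
    first-kind-near-c v c≢v near with near-c v c≢v near
    ... | inj₁ refl = _ , colour-a
    ... | inj₂ refl = _ , colour-b

  module NonTriangle (x≢c : x ≢ c) where

    x∉R : x ∉ R
    x∉R = ∉R (≢-sym (Edge⇒≢ G ax)) (≢-sym b≢x) x≢c

    y∉R : y ∉ R
    y∉R = ∉R y≢a (≢-sym b≢y) (≢-sym (Edge⇒≢ G cy))
      where
      y≢a : y ≢ a
      y≢a y≡a = [ b≢c ∘ sym , x≢c ∘ sym ]′ (a-nbrs c (Edge-sym G (subst (Edge G c) y≡a cy)))

    γx γy : Colour
    γx = κ (x , keep-∉ G R x∉R)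
    γy = κ (y , keep-∉ G R y∉R)

    free-colour : ∀ i → γx ≢ inj₁ i → γy ≢ inj₁ i → GraphPackingColorable G 2 (suc k)
    free-colour i x-free y-free = extend (inj₁ i) (inj₁ (other i)) (inj₁ i)
      (properAt-first-kind (Edge G) colour-a (neighbours-avoid (Edge G) a-nbrs
        (≡-≢-trans colour-b (inj₁≢inj₁-other i ∘ sym)) (≡-≢-trans (colour-outside x∉R) x-free)))
      (properAt-first-kind (Edge G) colour-b (neighbours-avoid (Edge G) b-nbrs
        (≡-≢-trans colour-a (inj₁≢inj₁-other i)) (≡-≢-trans colour-c (inj₁≢inj₁-other i))))
      (properAt-first-kind (Edge G) colour-c (neighbours-avoid (Edge G) c-nbrs
        (≡-≢-trans colour-b (inj₁≢inj₁-other i ∘ sym)) (≡-≢-trans (colour-outside y∉R) y-free)))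

    split-colours : ∀ j → γx ≡ inj₁ j → γy ≡ inj₁ (other j) → GraphPackingColorable G 2 (suc k)
    split-colours j x-col y-col = extend (inj₁ (other j)) (inj₂ zero) (inj₁ j)
      (properAt-first-kind (Edge G) colour-a (neighbours-avoid (Edge G) a-nbrs
        (≡-≢-trans colour-b (λ ())) (≡-≢-trans x-colour (inj₁≢inj₁-other j))))
      (properAt-second-kind (Edge G) colour-b first-kind-near-b)
      (properAt-first-kind (Edge G) colour-c (neighbours-avoid (Edge G) c-nbrs
        (≡-≢-trans colour-b (λ ())) (≡-≢-trans y-colour (inj₁≢inj₁-other j ∘ sym))))
      where
      colouring′ : Fin n → Colour
      colouring′ = colouring (inj₁ (other j)) (inj₂ zero) (inj₁ j)

      x-colour : colouring′ x ≡ inj₁ j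
      x-colour = trans (colour-outside x∉R) x-col

      y-colour : colouring′ y ≡ inj₁ (other j)
      y-colour = trans (colour-outside y∉R) y-col

      first-kind-near-b : ∀ v → b ≢ v → Within2 (Edge G) b v → ∃[ i ] colouring′ v ≡ inj₁ i
      first-kind-near-b v _ (inj₁ e) =
        [ first-kind-via colouring′ colour-a , first-kind-via colouring′ colour-c ]′ (b-nbrs v e)
      first-kind-near-b v b≢v (inj₂ (w , e₁ , e₂)) =
        [ (λ w≡a → beyond x-colour (a-nbrs v (subst (λ u → Edge G u v) w≡a e₂)))
        , (λ w≡c → beyond y-colour (c-nbrs v (subst (λ u → Edge G u v) w≡c e₂))) ]′ (b-nbrs w e₁)
        where
        beyond : ∀ {z i} → colouring′ z ≡ inj₁ i → v ≡ b ⊎ v ≡ z → ∃[ i ] colouring′ v ≡ inj₁ i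
        beyond _        (inj₁ v≡b) = contradiction (sym v≡b) b≢v
        beyond z-colour (inj₂ v≡z) = first-kind-via colouring′ z-colour v≡z

    extension : GraphPackingColorable G 2 (suc k)
    extension with missing-first-colour-or-both γx γy
    ... | inj₁ (i , x-free , y-free) = free-colour i x-free y-free
    ... | inj₂ (j , x-col , y-col)   = split-colours j x-col y-col

  extension : GraphPackingColorable G 2 (suc k)
  extension with x ≟ c
  ... | yes x≡c = triangle x≡c
  ... | no x≢c  = NonTriangle.extension x≢c

3-thread-extends : ∀ {k} (G : Graph) {a b c} → Edge G a b → Edge G b c → a ≢ c →
  degree G a ≡ 2 → degree G b ≡ 2 → degree G c ≡ 2 →
  SubPackingColorable (deleteVertices G (a ∷ b ∷ c ∷ [])) 2 (suc k) →
  GraphPackingColorable G 2 (suc k)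
3-thread-extends G ab bc a≢c deg-a deg-b deg-c (κ , κ-packing) =
  let ba = Edge-sym G ab
      cb = Edge-sym G bc
      x , ax , b≢x = degree-2-second-neighbour G deg-a ab
      y , cy , b≢y = degree-2-second-neighbour G deg-c cb
  in ThreadColouring.extension G ab bc ax cy a≢c b≢x b≢y
       (degree-2-neighbours G deg-a ab ax b≢x)
       (degree-2-neighbours G deg-b ba bc a≢c)
       (degree-2-neighbours G deg-c cb cy b≢y)
       κ (packing⇒properAt _ (κ , κ-packing))

corollary3p4 : (k : ℕ) → (G : Graph) →
    ¬ GraphPackingColorable G 2 (suc k) →
    ((H : Subgraph G) → IsProper H → SubPackingColorable H 2 (suc k)) →
    ¬ Has3Thread G
corollary3p4 k G not-colourable minimal (a , b , c , ab , bc , a≢c , deg-a , deg-b , deg-c) =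
  not-colourable (3-thread-extends G ab bc a≢c deg-a deg-b deg-c
    (minimal (deleteVertices G (a ∷ b ∷ c ∷ [])) (deleteVertices-proper G (a ∷ b ∷ c ∷ []) (here refl))))
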